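{- Let $G=(V,E,w)$ be a weighted undirected graph with $n=|V|$ vertices and conductance $\Phi_G>0$. Then every hierarchical clustering tree $\mathcal{T}$ of $G$ satisfies \[ \mathrm{cost}_G(\mathcal{T}) \leq \frac{9}{4\Phi_G}\cdot \min\left\{\frac{d_{\mathrm{avg}}}{d_{\min}},\ \frac{d_{\max}}{d_{\mathrm{avg}}}\right\}\cdot \mathsf{OPT}_G . \]
   Context: $G=(V,E,w)$ is an undirected graph with nonnegative edge weights $w_{uv}$. The degree of $u$ is $d_u=\sum_{v\in V} w_{uv}$; $d_{\min},d_{\max}$ are the minimum and maximum degrees and $d_{\mathrm{avg}}=\sum_{u\in V} d_u/n$. For $S\subseteq V$, $\mathrm{vol}(S)=\sum_{u\in S}d_u$, and for disjoint $S,T$, $w(S,T)$ is the total weight of edges with one endpoint in $S$ and the other in $T$. The conductance of a nonempty $S$ is $\Phi_G(S)=w(S,V\setminus S)/\mathrm{vol}(S)$, and $\Phi_G=\min\{\Phi_G(S): \emptyset\neq S\subset V,\ \mathrm{vol}(S)\le \mathrm{vol}(V)/2\}$. A hierarchical clustering (HC) tree of $G$ is a rooted binary tree whose leaves are in bijection with $V$; each node is identified with the set of vertices at the leaves of its subtree. For an HC tree $\mathcal{T}$, $\mathrm{cost}_G(\mathcal{T})=\sum_{e=\{u,v\}\in E} w_e\cdot |\mathsf{leaves}(\mathcal{T}[u\vee v])|$, where $u\vee v$ is the lowest common ancestor of the leaves $u,v$ and $\mathsf{leaves}(\mathcal{T}[N])$ is the set of leaves of the subtree rooted at $N$. $\mathsf{OPT}_G$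 is the minimum of $\mathrm{cost}_G(\mathcal{T})$ over all HC trees $\mathcal{T}$ of $G$.
   Formalization: The edge weights $w_{uv}$ take values in the nonnegative rationals. -}

module Defs where

open import Data.Bool using (Bool; true; false; if_then_else_; _∧_; not)
open import Data.Nat as ℕ using (ℕ; zero; suc)
open import Data.Fin using (Fin; zero; suc; toℕ)
open import Data.Fin.Properties using () renaming (_≟_ to _≟F_)
open import Data.Fin.Subset using (Subset; ⊤)
open import Data.Vec using (lookup)
open import Data.Integer using (+_)
open import Data.Rational using (ℚ; 0ℚ; _/_; _+_; _*_; _÷_; _⊓_; _⊔_; _≤_; _<_; ≢-nonZero)
open import Data.Rational.Properties using (_≟_)
open import Data.List using (List; []; _∷_; _++_; length)
open import Data.List.Membership.Propositional using (_∈_)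
open import Data.List.Relation.Unary.Any using (any?)
open import Data.List.Relation.Unary.Unique.Propositional using (Unique)
open import Data.Product using (Σ; _×_; ∃)
open import Relation.Nullary using (yes; no; ¬_; _×-dec_)
open import Relation.Binary.PropositionalEquality using (_≡_; _≢_)

ℕ→ℚ : ℕ → ℚ
ℕ→ℚ n = + n / 1

-- Division p / q, used only where q is positive under the hypotheses;
-- conventionally 0 when q = 0 (never used in that case).
_÷'_ : ℚ → ℚ → ℚ
p ÷' q with q ≟ 0ℚ
... | yes _ = 0ℚ
... | no q≢0 = _÷_ p q {{≢-nonZero q≢0}}

sumF : ∀ {n} → (Fin n → ℚ) → ℚ
sumF {zero} f = 0ℚ
sumF {suc n} f = f zero + sumF (λ i → f (suc i))

minF : ∀ {n} → (Fin (suc n) → ℚ) → ℚ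
minF {zero} f = f zero
minF {suc n} f = f zero ⊓ minF (λ i → f (suc i))

maxF : ∀ {n} → (Fin (suc n) → ℚ) → ℚ
maxF {zero} f = f zero
maxF {suc n} f = f zero ⊔ maxF (λ i → f (suc i))

record WGraph (n : ℕ) : Set where
  field
    w        : Fin n → Fin n → ℚ
    w-sym    : ∀ u v → w u v ≡ w v u
    w-nonneg : ∀ u v → 0ℚ ≤ w u v
    w-noloop : ∀ u → w u u ≡ 0ℚ
open WGraph public

module _ {n : ℕ} (G : WGraph n) where

  deg : Fin n → ℚ
  deg u = sumF (λ v → w G u v)

  vol : Subset n → ℚ
  vol S = sumF (λ u → if lookup S u then deg u else 0ℚ)

  cut : Subset n → ℚ
  cut S = sumF (λ u → sumF (λ v →
            if lookup S u ∧ not (lookup S v) then w G u v else 0ℚ))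

  condS : Subset n → ℚ
  condS S = cut S ÷' vol S

  Admissible : Subset n → Set
  Admissible S = (∃ λ u → lookup S u ≡ true)
               × (∃ λ u → lookup S u ≡ false)
               × (vol S ≤ vol ⊤ ÷' ℕ→ℚ 2)

  IsConductance : ℚ → Set
  IsConductance φ = (Σ (Subset n) λ S → Admissible S × condS S ≡ φ)
                  × (∀ S → Admissible S → φ ≤ condS S)


-- Hierarchical clustering trees: rooted (full) binary trees whose
-- leaves are labelled by vertices, the labelling being a bijection
-- onto Fin n.

data Tree (n : ℕ) : Set where
  leaf : Fin n → Tree n
  node : Tree n → Tree n → Tree n

leaves : ∀ {n} → Tree n → List (Fin n)
leaves (leaf v)   = v ∷ []
leaves (node l r) = leaves l ++ leaves r

IsHCTree : ∀ {n} → Tree n → Set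
IsHCTree {n} T = Unique (leaves T) × (∀ (v : Fin n) → v ∈ leaves T)

-- |leaves(T[u ∨ v])|: number of leaves of the subtree rooted at the
-- lowest common ancestor of the leaves u and v.
lcaSize : ∀ {n} → Tree n → Fin n → Fin n → ℕ
lcaSize (leaf x) u v = 1
lcaSize (node l r) u v with any? (u ≟F_) (leaves l) ×-dec any? (v ≟F_) (leaves l)
... | yes _ = lcaSize l u v
... | no _ with any? (u ≟F_) (leaves r) ×-dec any? (v ≟F_) (leaves r)
...   | yes _ = lcaSize r u v
...   | no _  = length (leaves (node l r))

module _ {n : ℕ} (G : WGraph n) where

  -- cost_G(T) = Σ_{edges {u,v}} w_uv · |leaves(T[u ∨ v])|;
  -- each unordered pair {u,v} (u ≠ v) is counted once, via u < v.
  cost : Tree n → ℚ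
  cost T = sumF (λ u → sumF (λ v →
             if toℕ u ℕ.<ᵇ toℕ v then w G u v * ℕ→ℚ (lcaSize T u v) else 0ℚ))

  IsOPT : ℚ → Set
  IsOPT c = (Σ (Tree n) λ T → IsHCTree T × cost T ≡ c)
          × (∀ T → IsHCTree T → c ≤ cost T)

module _ {n : ℕ} (G : WGraph n) where

  dAvg : ℚ
  dAvg = sumF (deg G) ÷' ℕ→ℚ n

-- d_min, d_max (value 0 for the empty graph; never used there)
dMin : ∀ {n} → WGraph n → ℚ
dMin {zero}  G = 0ℚ
dMin {suc m} G = minF (deg G)

dMax : ∀ {n} → WGraph n → ℚ
dMax {zero}  G = 0ℚ
dMax {suc m} G = maxF (deg G)

{-# OPTIONS --safe #-}
-- Every lca has at most n leaves, so every HC tree costs at most n·w(E) = n·vol(V)/2.  For the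
-- lower bound take a vertex weighting f of total M with α·f ≤ deg, f ≤ β and no vertex above M/2,
-- and walk down an optimal tree into the heavier child until the current node N weighs at most
-- 2M/3.  Then N together with its sibling R weighs more than 2M/3, so |N| + |R| ≥ 2M/(3β), while N
-- and its complement both weigh at least M/3, so by conductance at least φαM/3 of edge weight
-- leaves N; each such edge has an lca containing N ∪ R.  Hence 2φαM² ≤ 9β·OPT.  The weightings
-- f ≡ 1 (α = d_min, β = 1) and f = deg (α = 1, β = d_max) give the two ratios.
module Submission where

open import Defs
open import Data.Bool using (Bool; true; false; if_then_else_; _∧_; _∨_; not; _xor_)
open import Data.Bool.Properties using (∨-assoc)
open import Data.Empty using (⊥-elim)
open import Data.Fin using (Fin; zero; suc; toℕ; fromℕ<)
open import Data.Fin.Properties using (toℕ-injective) renaming (_≟_ to _≟F_)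
open import Data.Fin.Subset using (⊤)
import Data.Integer as ℤ
open import Data.List using (List; []; _∷_; _++_; length)
open import Data.List.Properties using (length-++)
open import Data.List.Membership.Propositional using (_∈_; _∉_)
open import Data.List.Membership.Propositional.Properties using (∈-++⁺ˡ; ∈-++⁺ʳ)
open import Data.List.Relation.Binary.Disjoint.Propositional using (Disjoint)
import Data.List.Relation.Unary.All as All
import Data.List.Relation.Unary.All.Properties as All
open import Data.List.Relation.Unary.AllPairs using ([]; _∷_)
open import Data.List.Relation.Unary.Any using (here; there; any?)
open import Data.List.Relation.Unary.Unique.Propositional using (Unique)
open import Data.List.Relation.Unary.Unique.Propositional.Properties using () renaming (++⁺ to Unique-++⁺)
open import Data.Nat as ℕ using (ℕ; zero; suc)
import Data.Nat.Properties as ℕ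
open import Data.Nat.Coprimality using (1-coprimeTo) renaming (sym to coprime-sym)
open import Data.Product using (_×_; _,_; proj₁; proj₂; ∃)
open import Data.Rational
open import Data.Rational.Properties
import Data.Rational.Unnormalised as ℚᵘ
import Data.Rational.Unnormalised.Properties as ℚᵘ
open import Data.Sum using (_⊎_; inj₁; inj₂)
open import Data.Unit using (tt)
open import Data.Vec using (lookup; tabulate)
open import Data.Vec.Properties using (lookup-replicate; lookup∘tabulate)
open import Relation.Binary.Definitions using (tri<; tri≈; tri>)
open import Relation.Binary.PropositionalEquality
open import Relation.Nullary using (yes; no; ¬_; does; Dec; _×-dec_; ofʸ; ofⁿ)
open import Relation.Nullary.Decidable using (toWitness)
import Data.Integer.Solver as ℤ-Solver
open import Data.Rational.Solver using (module +-*-Solver)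

ℕ→ℚ-suc : ∀ n → ℕ→ℚ (suc n) ≡ 1ℚ + ℕ→ℚ n
ℕ→ℚ-suc n = toℚᵘ-injective (begin
    toℚᵘ (ℕ→ℚ (suc n))                ≈⟨ ℚᵘ.≃-reflexive (cong toℚᵘ (as-mkℚ (suc n))) ⟩
    ℚᵘ.mkℚᵘ (ℤ.+ suc n) 0             ≈⟨ ℚᵘ.*≡* (ring-identity (ℤ.+ n)) ⟩
    toℚᵘ 1ℚ ℚᵘ.+ ℚᵘ.mkℚᵘ (ℤ.+ n) 0    ≈⟨ ℚᵘ.≃-reflexive (cong (toℚᵘ 1ℚ ℚᵘ.+_) (cong toℚᵘ (as-mkℚ n))) ⟨
    toℚᵘ 1ℚ ℚᵘ.+ toℚᵘ (ℕ→ℚ n)         ≈⟨ toℚᵘ-homo-+ 1ℚ (ℕ→ℚ n) ⟨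
    toℚᵘ (1ℚ + ℕ→ℚ n)                 ∎)
  where
  open ℚᵘ.≃-Reasoning
  as-mkℚ : ∀ m → ℕ→ℚ m ≡ mkℚ (ℤ.+ m) 0 (coprime-sym (1-coprimeTo m))
  as-mkℚ m = normalize-coprime (coprime-sym (1-coprimeTo m))
  open ℤ-Solver.+-*-Solver
  ring-identity : ∀ x → (ℤ.+ 1 ℤ.+ x) ℤ.* (ℤ.+ 1 ℤ.* ℤ.+ 1)
                      ≡ (ℤ.+ 1 ℤ.* ℤ.+ 1 ℤ.+ x ℤ.* ℤ.+ 1) ℤ.* ℤ.+ 1
  ring-identity = solve 1 (λ x → (con (ℤ.+ 1) :+ x) :* (con (ℤ.+ 1) :* con (ℤ.+ 1))
                               := (con (ℤ.+ 1) :* con (ℤ.+ 1) :+ x :* con (ℤ.+ 1)) :* con (ℤ.+ 1)) refl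

ℕ→ℚ-+ : ∀ a b → ℕ→ℚ (a ℕ.+ b) ≡ ℕ→ℚ a + ℕ→ℚ b
ℕ→ℚ-+ zero    b = sym (+-identityˡ (ℕ→ℚ b))
ℕ→ℚ-+ (suc a) b = begin
  ℕ→ℚ (suc (a ℕ.+ b))        ≡⟨ ℕ→ℚ-suc (a ℕ.+ b) ⟩
  1ℚ + ℕ→ℚ (a ℕ.+ b)         ≡⟨ cong (1ℚ +_) (ℕ→ℚ-+ a b) ⟩
  1ℚ + (ℕ→ℚ a + ℕ→ℚ b)       ≡⟨ +-assoc 1ℚ (ℕ→ℚ a) (ℕ→ℚ b) ⟨
  (1ℚ + ℕ→ℚ a) + ℕ→ℚ b       ≡⟨ cong (_+ ℕ→ℚ b) (ℕ→ℚ-suc a) ⟨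
  ℕ→ℚ (suc a) + ℕ→ℚ b        ∎
  where open ≡-Reasoning

ℕ→ℚ-nonneg : ∀ n → 0ℚ ≤ ℕ→ℚ n
ℕ→ℚ-nonneg n = nonNegative⁻¹ (ℕ→ℚ n) {{normalize-nonNeg n 1}}

ℕ→ℚ-mono-≤ : ∀ {a b} → a ℕ.≤ b → ℕ→ℚ a ≤ ℕ→ℚ b
ℕ→ℚ-mono-≤ {b = b} ℕ.z≤n = ℕ→ℚ-nonneg b
ℕ→ℚ-mono-≤ {suc a} {suc b} (ℕ.s≤s a≤b) =
  subst₂ _≤_ (sym (ℕ→ℚ-suc a)) (sym (ℕ→ℚ-suc b)) (+-monoʳ-≤ 1ℚ (ℕ→ℚ-mono-≤ a≤b))

ℕ→ℚ-pos : ∀ {n} → 1 ℕ.≤ n → 0ℚ < ℕ→ℚ n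
ℕ→ℚ-pos 1≤n = <-≤-trans (toWitness {a? = 0ℚ <? 1ℚ} tt) (ℕ→ℚ-mono-≤ 1≤n)

÷'-cancelʳ : ∀ p {q} → 0ℚ < q → (p ÷' q) * q ≡ p
÷'-cancelʳ p {q} q>0 with q ≟ 0ℚ
... | yes q≡0 = ⊥-elim (<-irrefl (sym q≡0) q>0)
... | no  q≢0 = begin
  p * 1/ q * q    ≡⟨ *-assoc p _ q ⟩
  p * (1/ q * q)  ≡⟨ cong (p *_) (*-inverseˡ q) ⟩
  p * 1ℚ          ≡⟨ *-identityʳ p ⟩
  p               ∎
  where
  open ≡-Reasoning
  instance _ = ≢-nonZero q≢0

*-nonneg : ∀ {p q} → 0ℚ ≤ p → 0ℚ ≤ q → 0ℚ ≤ p * q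
*-nonneg {p} {q} p≥0 q≥0 =
  nonNegative⁻¹ _ {{nonNeg*nonNeg⇒nonNeg p {{nonNegative p≥0}} q {{nonNegative q≥0}}}}

*-pos : ∀ {p q} → 0ℚ < p → 0ℚ < q → 0ℚ < p * q
*-pos {p} {q} p>0 q>0 = positive⁻¹ _ {{pos*pos⇒pos p {{positive p>0}} q {{positive q>0}}}}

*-monoʳ-≤-≥0 : ∀ {p q} r → 0ℚ ≤ r → p ≤ q → p * r ≤ q * r
*-monoʳ-≤-≥0 r r≥0 = *-monoʳ-≤-nonNeg r {{nonNegative r≥0}}

*-monoˡ-≤-≥0 : ∀ {p q} r → 0ℚ ≤ r → p ≤ q → r * p ≤ r * q
*-monoˡ-≤-≥0 r r≥0 = *-monoˡ-≤-nonNeg r {{nonNegative r≥0}}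

*-cancelʳ-≤->0 : ∀ {p q} r → 0ℚ < r → p * r ≤ q * r → p ≤ q
*-cancelʳ-≤->0 r r>0 = *-cancelʳ-≤-pos r {{positive r>0}}

÷'-pos : ∀ {p q} → 0ℚ < p → 0ℚ < q → 0ℚ < p ÷' q
÷'-pos {p} {q} p>0 q>0 = *-cancelʳ-<-nonNeg q {{nonNegative (<⇒≤ q>0)}}
  (subst₂ _<_ (sym (*-zeroˡ q)) (sym (÷'-cancelʳ p q>0)) p>0)

+-self-injective : ∀ {p q} → p + p ≡ q + q → p ≡ q
+-self-injective {p} {q} eq with <-cmp p q
... | tri< p<q _ _ = ⊥-elim (<-irrefl eq (+-mono-< p<q p<q))
... | tri≈ _ p≡q _ = p≡q
... | tri> _ _ p>q = ⊥-elim (<-irrefl (sym eq) (+-mono-< p>q p>q))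

sumF-cong : ∀ {n} {f g : Fin n → ℚ} → (∀ i → f i ≡ g i) → sumF f ≡ sumF g
sumF-cong {zero}  f≡g = refl
sumF-cong {suc n} f≡g = cong₂ _+_ (f≡g zero) (sumF-cong (λ i → f≡g (suc i)))

sumF-mono : ∀ {n} {f g : Fin n → ℚ} → (∀ i → f i ≤ g i) → sumF f ≤ sumF g
sumF-mono {zero}  f≤g = ≤-refl
sumF-mono {suc n} f≤g = +-mono-≤ (f≤g zero) (sumF-mono (λ i → f≤g (suc i)))

sumF-zero : ∀ n → sumF {n} (λ _ → 0ℚ) ≡ 0ℚ
sumF-zero zero    = refl
sumF-zero (suc n) = trans (+-identityˡ _) (sumF-zero n)

sumF-one : ∀ n → sumF {n} (λ _ → 1ℚ) ≡ ℕ→ℚ n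
sumF-one zero    = refl
sumF-one (suc n) = trans (cong (1ℚ +_) (sumF-one n)) (sym (ℕ→ℚ-suc n))

sumF-+ : ∀ {n} (f g : Fin n → ℚ) → sumF (λ i → f i + g i) ≡ sumF f + sumF g
sumF-+ {zero}  f g = refl
sumF-+ {suc n} f g = trans (cong (f zero + g zero +_) (sumF-+ (λ i → f (suc i)) (λ i → g (suc i))))
                           (+-interchange (f zero) (g zero) _ _)
  where
  open +-*-Solver
  +-interchange : ∀ a b c d → (a + b) + (c + d) ≡ (a + c) + (b + d)
  +-interchange = solve 4 (λ a b c d → (a :+ b) :+ (c :+ d) := (a :+ c) :+ (b :+ d)) refl

sumF-* : ∀ {n} c (f : Fin n → ℚ) → sumF (λ i → c * f i) ≡ c * sumF f
sumF-* {zero}  c f = sym (*-zeroʳ c)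
sumF-* {suc n} c f = trans (cong (c * f zero +_) (sumF-* c (λ i → f (suc i))))
                           (sym (*-distribˡ-+ c _ _))

sumF-nonneg : ∀ {n} {f : Fin n → ℚ} → (∀ i → 0ℚ ≤ f i) → 0ℚ ≤ sumF f
sumF-nonneg {n} {f} f≥0 = subst (_≤ sumF f) (sumF-zero n) (sumF-mono f≥0)

sumF-≥-term : ∀ {n} {f : Fin n → ℚ} → (∀ i → 0ℚ ≤ f i) → ∀ j → f j ≤ sumF f
sumF-≥-term {suc n} {f} f≥0 zero =
  subst (_≤ sumF f) (+-identityʳ (f zero)) (+-monoʳ-≤ (f zero) (sumF-nonneg (λ i → f≥0 (suc i))))
sumF-≥-term {suc n} {f} f≥0 (suc j) =
  subst (_≤ sumF f) (+-identityˡ (f (suc j))) (+-mono-≤ (f≥0 zero) (sumF-≥-term (λ i → f≥0 (suc i)) j))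

sumF-swap : ∀ {n m} (f : Fin n → Fin m → ℚ) →
            sumF (λ i → sumF (λ j → f i j)) ≡ sumF (λ j → sumF (λ i → f i j))
sumF-swap {zero}  {m} f = sym (sumF-zero m)
sumF-swap {suc n} {m} f = trans (cong (sumF (f zero) +_) (sumF-swap (λ i → f (suc i))))
                                (sym (sumF-+ (f zero) (λ j → sumF (λ i → f (suc i) j))))

upper : ∀ {n} → (Fin n → Fin n → ℚ) → Fin n → Fin n → ℚ
upper f u v = if toℕ u ℕ.<ᵇ toℕ v then f u v else 0ℚ

ΣΣ : ∀ {n} → (Fin n → Fin n → ℚ) → ℚ
ΣΣ f = sumF (λ u → sumF (λ v → f u v))

module _ {n : ℕ} (f : Fin n → Fin n → ℚ)
         (f-sym : ∀ u v → f u v ≡ f v u) (f-diag : ∀ u → f u u ≡ 0ℚ) where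

  upper-split : ∀ u v → f u v ≡ upper f u v + upper f v u
  upper-split u v with toℕ u ℕ.<ᵇ toℕ v | ℕ.<ᵇ-reflects-< (toℕ u) (toℕ v)
                     | toℕ v ℕ.<ᵇ toℕ u | ℕ.<ᵇ-reflects-< (toℕ v) (toℕ u)
  ... | true  | ofʸ u<v | true  | ofʸ v<u = ⊥-elim (ℕ.<-asym u<v v<u)
  ... | true  | _       | false | _       = sym (+-identityʳ (f u v))
  ... | false | _       | true  | _       = trans (f-sym u v) (sym (+-identityˡ (f v u)))
  ... | false | ofⁿ u≮v | false | ofⁿ v≮u = begin
    f u v      ≡⟨ cong (λ x → f x v) u≡v ⟩
    f v v      ≡⟨ f-diag v ⟩
    0ℚ         ≡⟨ +-identityˡ 0ℚ ⟨
    0ℚ + 0ℚ    ∎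
    where
    open ≡-Reasoning
    u≡v : u ≡ v
    u≡v = toℕ-injective (ℕ.≤-antisym (ℕ.≮⇒≥ v≮u) (ℕ.≮⇒≥ u≮v))

  ΣΣ-upper : ΣΣ f ≡ ΣΣ (upper f) + ΣΣ (upper f)
  ΣΣ-upper = begin
    ΣΣ f
      ≡⟨ sumF-cong (λ u → sumF-cong (upper-split u)) ⟩
    sumF (λ u → sumF (λ v → upper f u v + upper f v u))
      ≡⟨ sumF-cong (λ u → sumF-+ (upper f u) (λ v → upper f v u)) ⟩
    sumF (λ u → sumF (upper f u) + sumF (λ v → upper f v u))
      ≡⟨ sumF-+ (λ u → sumF (upper f u)) _ ⟩
    ΣΣ (upper f) + sumF (λ u → sumF (λ v → upper f v u))
      ≡⟨ cong (ΣΣ (upper f) +_) (sumF-swap (λ u v → upper f v u)) ⟩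
    ΣΣ (upper f) + ΣΣ (upper f)
      ∎
    where open ≡-Reasoning

-- vol G S is definitionally mass (deg G) (lookup S).
mass : ∀ {n} → (Fin n → ℚ) → (Fin n → Bool) → ℚ
mass f S = sumF (λ u → if S u then f u else 0ℚ)

module _ {n : ℕ} {f : Fin n → ℚ} where

  mass-mono : ∀ {g} → (∀ u → f u ≤ g u) → ∀ S → mass f S ≤ mass g S
  mass-mono {g} f≤g S = sumF-mono (λ u → pointwise (S u))
    where
    pointwise : ∀ {u} b → (if b then f u else 0ℚ) ≤ (if b then g u else 0ℚ)
    pointwise true  = f≤g _
    pointwise false = ≤-refl

  mass-* : ∀ c S → mass (λ u → c * f u) S ≡ c * mass f S
  mass-* c S = trans (sumF-cong (λ u → pointwise (S u))) (sumF-* {n} c _)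
    where
    pointwise : ∀ {u} b → (if b then c * f u else 0ℚ) ≡ c * (if b then f u else 0ℚ)
    pointwise true  = refl
    pointwise false = sym (*-zeroʳ c)

  mass-≥-member : (∀ u → 0ℚ ≤ f u) → ∀ S {u} → S u ≡ true → f u ≤ mass f S
  mass-≥-member f≥0 S {u} Su = subst (_≤ mass f S) (cong (λ b → if b then f u else 0ℚ) Su)
                                      (sumF-≥-term (λ v → nonneg (S v)) u)
    where
    nonneg : ∀ {v} b → 0ℚ ≤ (if b then f v else 0ℚ)
    nonneg true  = f≥0 _
    nonneg false = ≤-refl

  mass-complement : ∀ S → mass f S + mass f (λ u → not (S u)) ≡ sumF f
  mass-complement S = trans (sym (sumF-+ {n} _ _)) (sumF-cong (λ u → pointwise (S u)))
    where
    pointwise : ∀ {u} b → (if b then f u else 0ℚ) + (if not b then f u else 0ℚ) ≡ f u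
    pointwise true  = +-identityʳ _
    pointwise false = +-identityˡ _

  mass-full : ∀ {S} → (∀ u → S u ≡ true) → mass f S ≡ sumF f
  mass-full S≡true = sumF-cong (λ u → cong (λ b → if b then f u else 0ℚ) (S≡true u))

member : ∀ {n} → List (Fin n) → Fin n → Bool
member xs u = does (any? (u ≟F_) xs)

module _ {n : ℕ} where

  member-++ : ∀ (xs ys : List (Fin n)) u → member (xs ++ ys) u ≡ member xs u ∨ member ys u
  member-++ []       ys u = refl
  member-++ (x ∷ xs) ys u = trans (cong (does (u ≟F x) ∨_) (member-++ xs ys u))
                                  (sym (∨-assoc (does (u ≟F x)) _ _))

  member⇒∈ : ∀ {xs : List (Fin n)} {u} → member xs u ≡ true → u ∈ xs
  member⇒∈ {xs} {u} eq with any? (u ≟F_) xs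
  ... | yes u∈xs = u∈xs

  ∈⇒member : ∀ {xs : List (Fin n)} {u} → u ∈ xs → member xs u ≡ true
  ∈⇒member {xs} {u} u∈xs with any? (u ≟F_) xs
  ... | yes _   = refl
  ... | no  u∉xs = ⊥-elim (u∉xs u∈xs)

  ∉⇒member : ∀ {xs : List (Fin n)} {u} → u ∉ xs → member xs u ≡ false
  ∉⇒member {xs} {u} u∉xs with any? (u ≟F_) xs
  ... | yes u∈xs = ⊥-elim (u∉xs u∈xs)
  ... | no  _    = refl

  member⇒∉ : ∀ {xs : List (Fin n)} {u} → member xs u ≡ false → u ∉ xs
  member⇒∉ eq u∈xs with trans (sym eq) (∈⇒member u∈xs)
  ... | ()

  Unique-++⁻ : ∀ (xs : List (Fin n)) {ys} → Unique (xs ++ ys) → Unique xs × Unique ys × Disjoint xs ys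
  Unique-++⁻ []       u = [] , u , λ ()
  Unique-++⁻ (x ∷ xs) (x∉ ∷ u) with Unique-++⁻ xs u
  ... | uxs , uys , xs#ys = All.++⁻ˡ xs x∉ ∷ uxs , uys , disjoint
    where
    disjoint : Disjoint (x ∷ xs) _
    disjoint (here refl , v∈ys) = All.lookup (All.++⁻ʳ xs x∉) v∈ys refl
    disjoint (there v∈xs , v∈ys) = xs#ys (v∈xs , v∈ys)

module _ {n : ℕ} {f : Fin n → ℚ} where

  mass-++ : ∀ {xs ys : List (Fin n)} → Disjoint xs ys →
            mass f (member (xs ++ ys)) ≡ mass f (member xs) + mass f (member ys)
  mass-++ {xs} {ys} xs#ys = trans (sumF-cong pointwise) (sumF-+ {n} _ _)
    where
    pointwise : ∀ u → (if member (xs ++ ys) u then f u else 0ℚ)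
                    ≡ (if member xs u then f u else 0ℚ) + (if member ys u then f u else 0ℚ)
    pointwise u rewrite member-++ xs ys u with member xs u in u∈xs | member ys u in u∈ys
    ... | true  | true  = ⊥-elim (xs#ys (member⇒∈ u∈xs , member⇒∈ u∈ys))
    ... | true  | false = sym (+-identityʳ (f u))
    ... | false | true  = sym (+-identityˡ (f u))
    ... | false | false = sym (+-identityˡ 0ℚ)

  mass-[_] : ∀ x → mass f (member (x ∷ [])) ≡ f x
  mass-[ x ] = point-mass f x
    where
    point-mass : ∀ {m} (g : Fin m → ℚ) x → sumF (λ u → if does (u ≟F x) ∨ false then g u else 0ℚ) ≡ g x
    point-mass {suc m} g zero    = trans (cong (g zero +_) (sumF-zero m)) (+-identityʳ (g zero))
    point-mass {suc m} g (suc x) = trans (+-identityˡ _) (point-mass (λ i → g (suc i)) x)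

mass-const : ∀ {n} c {xs : List (Fin n)} → Unique xs → mass (λ _ → c) (member xs) ≡ c * ℕ→ℚ (length xs)
mass-const {n} c {[]}     _ = trans (sumF-zero n) (sym (*-zeroʳ c))
mass-const {n} c {x ∷ xs} u with Unique-++⁻ (x ∷ []) u
... | _ , uxs , x#xs = begin
  mass (λ _ → c) (member (x ∷ xs))         ≡⟨ mass-++ x#xs ⟩
  mass (λ _ → c) (member (x ∷ [])) + mass (λ _ → c) (member xs)
                                            ≡⟨ cong (_+ _) mass-[ x ] ⟩
  c + mass (λ _ → c) (member xs)           ≡⟨ cong (c +_) (mass-const c uxs) ⟩
  c + c * ℕ→ℚ (length xs)                   ≡⟨ cong (_+ c * ℕ→ℚ (length xs)) (*-identityʳ c) ⟨
  c * 1ℚ + c * ℕ→ℚ (length xs)              ≡⟨ *-distribˡ-+ c 1ℚ _ ⟨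
  c * (1ℚ + ℕ→ℚ (length xs))                ≡⟨ cong (c *_) (ℕ→ℚ-suc (length xs)) ⟨
  c * ℕ→ℚ (length (x ∷ xs))                 ∎
  where open ≡-Reasoning

size : ∀ {n} → Tree n → ℕ
size T = length (leaves T)

weight : ∀ {n} → (Fin n → ℚ) → Tree n → ℚ
weight f T = mass f (member (leaves T))

data Siblings {n} (N R : Tree n) : Tree n → Set where
  left-child  : Siblings N R (node N R)
  right-child : Siblings N R (node R N)
  in-left     : ∀ {l r} → Siblings N R l → Siblings N R (node l r)
  in-right    : ∀ {l r} → Siblings N R r → Siblings N R (node l r)

module _ {n : ℕ} {N R : Tree n} where

  siblings-size : ∀ {T} → Siblings N R T → size N ℕ.+ size R ℕ.≤ size T
  siblings-size left-child               = ℕ.≤-reflexive (sym (length-++ (leaves N)))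
  siblings-size right-child              = ℕ.≤-reflexive (trans (ℕ.+-comm (size N) (size R))
                                                                (sym (length-++ (leaves R))))
  siblings-size (in-left {l} {r} s)      = ℕ.≤-trans (siblings-size s)
    (subst (size l ℕ.≤_) (sym (length-++ (leaves l))) (ℕ.m≤m+n (size l) (size r)))
  siblings-size (in-right {l} {r} s)     = ℕ.≤-trans (siblings-size s)
    (subst (size r ℕ.≤_) (sym (length-++ (leaves l))) (ℕ.m≤n+m (size r) (size l)))

  siblings-∈ : ∀ {T u} → Siblings N R T → u ∈ leaves N → u ∈ leaves T
  siblings-∈ left-child         u∈N = ∈-++⁺ˡ u∈N
  siblings-∈ right-child        u∈N = ∈-++⁺ʳ (leaves R) u∈N
  siblings-∈ (in-left s)        u∈N = ∈-++⁺ˡ (siblings-∈ s u∈N)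
  siblings-∈ (in-right {l} s)   u∈N = ∈-++⁺ʳ (leaves l) (siblings-∈ s u∈N)

  siblings-Unique : ∀ {T} → Unique (leaves T) → Siblings N R T → Unique (leaves N ++ leaves R)
  siblings-Unique uT left-child = uT
  siblings-Unique uT right-child with Unique-++⁻ (leaves R) uT
  ... | uR , uN , R#N = Unique-++⁺ uN uR (λ (x∈N , x∈R) → R#N (x∈R , x∈N))
  siblings-Unique uT (in-left {l} s)  = siblings-Unique (proj₁ (Unique-++⁻ (leaves l) uT)) s
  siblings-Unique uT (in-right {l} s) = siblings-Unique (proj₁ (proj₂ (Unique-++⁻ (leaves l) uT))) s

leaves-nonempty : ∀ {n} (T : Tree n) → ∃ λ u → u ∈ leaves T
leaves-nonempty (leaf x)   = x , here refl
leaves-nonempty (node l r) = let u , u∈l = leaves-nonempty l in u , ∈-++⁺ˡ u∈l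

Separates : ∀ {n} → Tree n → Fin n → Fin n → Set
Separates N u v = (u ∈ leaves N × v ∉ leaves N) ⊎ (v ∈ leaves N × u ∉ leaves N)

module _ {n : ℕ} {u v : Fin n} where

  lcaSize-≤ : ∀ T → lcaSize T u v ℕ.≤ size T
  lcaSize-≤ (leaf x) = ℕ.≤-refl
  lcaSize-≤ (node l r) with any? (u ≟F_) (leaves l) ×-dec any? (v ≟F_) (leaves l)
  ... | yes _ = ℕ.≤-trans (lcaSize-≤ l)
                  (subst (size l ℕ.≤_) (sym (length-++ (leaves l))) (ℕ.m≤m+n (size l) (size r)))
  ... | no _ with any? (u ≟F_) (leaves r) ×-dec any? (v ≟F_) (leaves r)
  ...   | yes _ = ℕ.≤-trans (lcaSize-≤ r)
                    (subst (size r ℕ.≤_) (sym (length-++ (leaves l))) (ℕ.m≤n+m (size r) (size l)))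
  ...   | no _  = ℕ.≤-refl

  lcaSize-left : ∀ {l r} → u ∈ leaves l → v ∈ leaves l → lcaSize (node l r) u v ≡ lcaSize l u v
  lcaSize-left {l} u∈l v∈l with any? (u ≟F_) (leaves l) ×-dec any? (v ≟F_) (leaves l)
  ... | yes _     = refl
  ... | no ¬both = ⊥-elim (¬both (u∈l , v∈l))

  lcaSize-right : ∀ {l r} → ¬ (u ∈ leaves l × v ∈ leaves l) → u ∈ leaves r → v ∈ leaves r →
                  lcaSize (node l r) u v ≡ lcaSize r u v
  lcaSize-right {l} {r} ¬both-l u∈r v∈r with any? (u ≟F_) (leaves l) ×-dec any? (v ≟F_) (leaves l)
  ... | yes both-l = ⊥-elim (¬both-l both-l)
  ... | no _ with any? (u ≟F_) (leaves r) ×-dec any? (v ≟F_) (leaves r)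
  ...   | yes _      = refl
  ...   | no ¬both-r = ⊥-elim (¬both-r (u∈r , v∈r))

  lcaSize-root : ∀ {l r} → ¬ (u ∈ leaves l × v ∈ leaves l) → ¬ (u ∈ leaves r × v ∈ leaves r) →
                 lcaSize (node l r) u v ≡ size (node l r)
  lcaSize-root {l} {r} ¬both-l ¬both-r with any? (u ≟F_) (leaves l) ×-dec any? (v ≟F_) (leaves l)
  ... | yes both-l = ⊥-elim (¬both-l both-l)
  ... | no _ with any? (u ≟F_) (leaves r) ×-dec any? (v ≟F_) (leaves r)
  ...   | yes both-r = ⊥-elim (¬both-r both-r)
  ...   | no _       = refl

  separates-¬both : ∀ {N} → Separates N u v → ¬ (u ∈ leaves N × v ∈ leaves N)
  separates-¬both (inj₁ (_ , v∉N)) (_ , v∈N) = v∉N v∈N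
  separates-¬both (inj₂ (_ , u∉N)) (u∈N , _) = u∉N u∈N

  separates-¬both-outside : ∀ {N xs} → (∀ {x} → x ∈ leaves N → x ∉ xs) → Separates N u v →
                            ¬ (u ∈ xs × v ∈ xs)
  separates-¬both-outside N∩xs=∅ (inj₁ (u∈N , _)) (u∈xs , _) = N∩xs=∅ u∈N u∈xs
  separates-¬both-outside N∩xs=∅ (inj₂ (v∈N , _)) (_ , v∈xs) = N∩xs=∅ v∈N v∈xs

  both? : ∀ xs → Dec (u ∈ xs × v ∈ xs)
  both? xs = any? (u ≟F_) xs ×-dec any? (v ≟F_) xs

  siblings-≤-lcaSize : ∀ {N R T} → Unique (leaves T) → Siblings N R T → Separates N u v →
                       size N ℕ.+ size R ℕ.≤ lcaSize T u v
  siblings-≤-lcaSize {N} {R} uT s@left-child sep with Unique-++⁻ (leaves N) uT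
  ... | _ , _ , N#R = subst (_ ℕ.≤_) (sym (lcaSize-root {N} {R} (separates-¬both {N} sep)
                        (separates-¬both-outside {N} (λ x∈N x∈R → N#R (x∈N , x∈R)) sep))) (siblings-size s)
  siblings-≤-lcaSize {N} {R} uT s@right-child sep with Unique-++⁻ (leaves R) uT
  ... | _ , _ , R#N = subst (_ ℕ.≤_) (sym (lcaSize-root {R} {N}
                        (separates-¬both-outside {N} (λ x∈N x∈R → R#N (x∈R , x∈N)) sep)
                        (separates-¬both {N} sep))) (siblings-size s)
  siblings-≤-lcaSize {N} {R} uT (in-left {l} {r} s) sep with Unique-++⁻ (leaves l) uT
  ... | ul , _ , l#r = by-cases (both? (leaves l))
    where
    by-cases : Dec (u ∈ leaves l × v ∈ leaves l) → size N ℕ.+ size R ℕ.≤ lcaSize (node l r) u v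
    by-cases (yes (u∈l , v∈l)) = subst (_ ℕ.≤_) (sym (lcaSize-left {l} {r} u∈l v∈l))
                                   (siblings-≤-lcaSize ul s sep)
    by-cases (no ¬both-l)      = subst (_ ℕ.≤_) (sym (lcaSize-root {l} {r} ¬both-l
                                   (separates-¬both-outside {N} (λ x∈N x∈r → l#r (siblings-∈ s x∈N , x∈r)) sep)))
                                   (siblings-size (in-left {r = r} s))
  siblings-≤-lcaSize {N} {R} uT (in-right {l} {r} s) sep with Unique-++⁻ (leaves l) uT
  ... | _ , ur , l#r = by-cases (both? (leaves r))
    where
    ¬both-l : ¬ (u ∈ leaves l × v ∈ leaves l)
    ¬both-l = separates-¬both-outside {N} (λ x∈N x∈l → l#r (x∈l , siblings-∈ s x∈N)) sep
    by-cases : Dec (u ∈ leaves r × v ∈ leaves r) → size N ℕ.+ size R ℕ.≤ lcaSize (node l r) u v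
    by-cases (yes (u∈r , v∈r)) = subst (_ ℕ.≤_) (sym (lcaSize-right {l} {r} ¬both-l u∈r v∈r))
                                   (siblings-≤-lcaSize ur s sep)
    by-cases (no ¬both-r)      = subst (_ ℕ.≤_) (sym (lcaSize-root {l} {r} ¬both-l ¬both-r))
                                   (siblings-size (in-right {l = l} s))

record BalancedSiblings {n} (f : Fin n → ℚ) (θ : ℚ) (T : Tree n) : Set where
  constructor balanced
  field
    {N R}    : Tree n
    siblings : Siblings N R T
    N-light  : weight f N ≤ θ
    NR-heavy : θ < weight f N + weight f R
    R≤N      : weight f R ≤ weight f N

weight-node : ∀ {n} {f : Fin n → ℚ} {l r} → Unique (leaves (node l r)) →
              weight f (node l r) ≡ weight f l + weight f r
weight-node {l = l} uT = mass-++ (proj₂ (proj₂ (Unique-++⁻ (leaves l) uT)))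

module _ {n : ℕ} {f : Fin n → ℚ} {θ : ℚ} (f≤θ : ∀ v → f v ≤ θ) where

  balanced-siblings : ∀ T → Unique (leaves T) → θ < weight f T → BalancedSiblings f θ T
  balanced-siblings (leaf v)   _  θ<fv =
    ⊥-elim (<-irrefl refl (<-≤-trans θ<fv (subst (_≤ θ) (sym mass-[ v ]) (f≤θ v))))
  balanced-siblings (node l r) uT θ<lr with Unique-++⁻ (leaves l) uT
  ... | ul , ur , _ with ≤-total (weight f l) (weight f r)
  ...   | inj₁ l≤r with weight f r ≤? θ
  ...     | yes r≤θ = balanced right-child r≤θ
                        (subst (θ <_) (trans (weight-node {l = l} {r} uT) (+-comm (weight f l) (weight f r))) θ<lr) l≤r
  ...     | no  r≰θ = let balanced s a b c = balanced-siblings r ur (≰⇒> r≰θ) in balanced (in-right s) a b c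
  balanced-siblings (node l r) uT θ<lr | ul , ur , _ | inj₂ r≤l with weight f l ≤? θ
  ...     | yes l≤θ = balanced left-child l≤θ (subst (θ <_) (weight-node {l = l} {r} uT) θ<lr) r≤l
  ...     | no  l≰θ = let balanced s a b c = balanced-siblings l ul (≰⇒> l≰θ) in balanced (in-left s) a b c

module _ {n : ℕ} (G : WGraph n) where

  deg-nonneg : ∀ u → 0ℚ ≤ deg G u
  deg-nonneg u = sumF-nonneg (w-nonneg G u)

  edge-weight : ℚ
  edge-weight = ΣΣ (upper (w G))

  handshake : sumF (deg G) ≡ edge-weight + edge-weight
  handshake = ΣΣ-upper (w G) (w-sym G) (w-noloop G)

  deg-≤-half : ∀ v → deg G v + deg G v ≤ sumF (deg G)
  deg-≤-half v = begin
    deg G v + deg G v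
                               ≡⟨ cong₂ _+_ (sym mass-[ v ]) (sumF-cong (λ u → w-sym G v u)) ⟩
    mass (deg G) (member (v ∷ [])) + sumF (λ u → w G u v)         ≡⟨ sumF-+ {n} _ _ ⟨
    sumF (λ u → (if member (v ∷ []) u then deg G u else 0ℚ) + w G u v)
                                                                  ≤⟨ sumF-mono pointwise ⟩
    sumF (deg G)                                                  ∎
    where
    open ≤-Reasoning
    pointwise : ∀ u → (if member (v ∷ []) u then deg G u else 0ℚ) + w G u v ≤ deg G u
    pointwise u with u ≟F v
    ... | yes refl = ≤-reflexive (trans (cong (deg G u +_) (w-noloop G u)) (+-identityʳ (deg G u)))
    ... | no  _    = subst (_≤ deg G u) (sym (+-identityˡ (w G u v))) (sumF-≥-term (w-nonneg G u) v)

module _ {n : ℕ} where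

  ΣΣ-upper-mono : ∀ {f g : Fin n → Fin n → ℚ} → (∀ u v → f u v ≤ g u v) → ΣΣ (upper f) ≤ ΣΣ (upper g)
  ΣΣ-upper-mono {f} {g} f≤g = sumF-mono (λ u → sumF-mono (λ v → pointwise u v))
    where
    pointwise : ∀ u v → upper f u v ≤ upper g u v
    pointwise u v with toℕ u ℕ.<ᵇ toℕ v
    ... | true  = f≤g u v
    ... | false = ≤-refl

  ΣΣ-upper-* : ∀ c (f : Fin n → Fin n → ℚ) → ΣΣ (upper (λ u v → c * f u v)) ≡ c * ΣΣ (upper f)
  ΣΣ-upper-* c f = begin
    ΣΣ (upper (λ u v → c * f u v))            ≡⟨ sumF-cong (λ u → sumF-cong (pointwise u)) ⟩
    sumF (λ u → sumF (λ v → c * upper f u v)) ≡⟨ sumF-cong (λ u → sumF-* c (upper f u)) ⟩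
    sumF (λ u → c * sumF (upper f u))         ≡⟨ sumF-* c (λ u → sumF (upper f u)) ⟩
    c * ΣΣ (upper f)                          ∎
    where
    open ≡-Reasoning
    pointwise : ∀ u v → upper (λ u v → c * f u v) u v ≡ c * upper f u v
    pointwise u v with toℕ u ℕ.<ᵇ toℕ v
    ... | true  = refl
    ... | false = sym (*-zeroʳ c)

HCTree-size : ∀ {n} {T : Tree n} → IsHCTree T → ℕ→ℚ (size T) ≡ ℕ→ℚ n
HCTree-size {n} {T} (unique , complete) = begin
  ℕ→ℚ (size T)                     ≡⟨ *-identityˡ _ ⟨
  1ℚ * ℕ→ℚ (size T)                ≡⟨ mass-const 1ℚ unique ⟨
  mass (λ _ → 1ℚ) (member (leaves T)) ≡⟨ mass-full (λ u → ∈⇒member (complete u)) ⟩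
  sumF {n} (λ _ → 1ℚ)              ≡⟨ sumF-one n ⟩
  ℕ→ℚ n                            ∎
  where open ≡-Reasoning

boundary : ∀ {n} → WGraph n → (Fin n → Bool) → Fin n → Fin n → ℚ
boundary G S u v = if S u xor S v then w G u v else 0ℚ

module _ {n : ℕ} (G : WGraph n) {T : Tree n} (hc : IsHCTree T) where

  -- cost G T is definitionally ΣΣ (upper (λ u v → w G u v * ℕ→ℚ (lcaSize T u v))).
  cost-upper : cost G T + cost G T ≤ ℕ→ℚ n * sumF (deg G)
  cost-upper = begin
    cost G T + cost G T                           ≤⟨ +-mono-≤ single single ⟩
    ℕ→ℚ n * edge-weight G + ℕ→ℚ n * edge-weight G ≡⟨ *-distribˡ-+ (ℕ→ℚ n) _ _ ⟨
    ℕ→ℚ n * (edge-weight G + edge-weight G)       ≡⟨ cong (ℕ→ℚ n *_) (handshake G) ⟨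
    ℕ→ℚ n * sumF (deg G)                          ∎
    where
    open ≤-Reasoning
    pointwise : ∀ u v → w G u v * ℕ→ℚ (lcaSize T u v) ≤ ℕ→ℚ n * w G u v
    pointwise u v = subst (w G u v * _ ≤_) (*-comm (w G u v) (ℕ→ℚ n))
      (*-monoˡ-≤-≥0 (w G u v) (w-nonneg G u v)
        (subst (ℕ→ℚ (lcaSize T u v) ≤_) (HCTree-size {T = T} hc) (ℕ→ℚ-mono-≤ (lcaSize-≤ T))))
    single : cost G T ≤ ℕ→ℚ n * edge-weight G
    single = ≤-trans (ΣΣ-upper-mono pointwise) (≤-reflexive (ΣΣ-upper-* (ℕ→ℚ n) (w G)))

  cost-lower : ∀ {N R} → Siblings N R T →
               ℕ→ℚ (size N ℕ.+ size R) * ΣΣ (upper (boundary G (member (leaves N)))) ≤ cost G T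
  cost-lower {N} {R} s = begin
    K * ΣΣ (upper (boundary G (member (leaves N))))     ≡⟨ ΣΣ-upper-* K (boundary G (member (leaves N))) ⟨
    ΣΣ (upper (λ u v → K * boundary G (member (leaves N)) u v))
                                                        ≤⟨ ΣΣ-upper-mono pointwise ⟩
    cost G T                                            ∎
    where
    open ≤-Reasoning
    K = ℕ→ℚ (size N ℕ.+ size R)
    separated : ∀ {u v} → Separates N u v → K * w G u v ≤ w G u v * ℕ→ℚ (lcaSize T u v)
    separated {u} {v} sep = subst (_≤ w G u v * _) (*-comm (w G u v) K)
      (*-monoˡ-≤-≥0 (w G u v) (w-nonneg G u v) (ℕ→ℚ-mono-≤ (siblings-≤-lcaSize (proj₁ hc) s sep)))
    pointwise : ∀ u v → K * boundary G (member (leaves N)) u v ≤ w G u v * ℕ→ℚ (lcaSize T u v)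
    pointwise u v with member (leaves N) u in u∈N | member (leaves N) v in v∈N
    ... | true  | false = separated (inj₁ (member⇒∈ u∈N , member⇒∉ v∈N))
    ... | false | true  = separated (inj₂ (member⇒∈ v∈N , member⇒∉ u∈N))
    ... | true  | true  = subst (_≤ _) (sym (*-zeroʳ K)) (*-nonneg (w-nonneg G u v) (ℕ→ℚ-nonneg (lcaSize T u v)))
    ... | false | false = subst (_≤ _) (sym (*-zeroʳ K)) (*-nonneg (w-nonneg G u v) (ℕ→ℚ-nonneg (lcaSize T u v)))

module _ {n : ℕ} (G : WGraph n) where

  cutᵇ : (Fin n → Bool) → ℚ
  cutᵇ S = ΣΣ (λ u v → if S u ∧ not (S v) then w G u v else 0ℚ)

  cut-tabulate : ∀ S → cut G (tabulate S) ≡ cutᵇ S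
  cut-tabulate S = sumF-cong (λ u → sumF-cong (λ v →
    cong₂ (λ a b → if a ∧ not b then w G u v else 0ℚ) (lookup∘tabulate S u) (lookup∘tabulate S v)))

  vol-tabulate : ∀ S → vol G (tabulate S) ≡ mass (deg G) S
  vol-tabulate S = sumF-cong (λ u → cong (λ b → if b then deg G u else 0ℚ) (lookup∘tabulate S u))

  vol-⊤ : vol G ⊤ ≡ sumF (deg G)
  vol-⊤ = mass-full {n} {deg G} (λ u → lookup-replicate u true)

  cutᵇ-not : ∀ S → cutᵇ (λ u → not (S u)) ≡ cutᵇ S
  cutᵇ-not S = trans (sumF-swap (λ u v → if not (S u) ∧ not (not (S v)) then w G u v else 0ℚ))
                     (sumF-cong (λ v → sumF-cong (λ u → pointwise v u (S u) (S v))))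
    where
    pointwise : ∀ v u a b → (if not a ∧ not (not b) then w G u v else 0ℚ) ≡ (if b ∧ not a then w G v u else 0ℚ)
    pointwise v u true  true  = refl
    pointwise v u true  false = refl
    pointwise v u false true  = w-sym G u v
    pointwise v u false false = refl

  ΣΣ-boundary : ∀ S → ΣΣ (boundary G S) ≡ cutᵇ S + cutᵇ (λ u → not (S u))
  ΣΣ-boundary S = trans (sumF-cong (λ u → trans (sumF-cong (λ v → pointwise u v (S u) (S v))) (sumF-+ {n} _ _)))
                        (sumF-+ {n} _ _)
    where
    pointwise : ∀ u v a b → (if a xor b then w G u v else 0ℚ)
                          ≡ (if a ∧ not b then w G u v else 0ℚ) + (if not a ∧ not (not b) then w G u v else 0ℚ)
    pointwise u v true  true  = sym (+-identityˡ 0ℚ)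
    pointwise u v true  false = sym (+-identityʳ _)
    pointwise u v false true  = sym (+-identityˡ _)
    pointwise u v false false = sym (+-identityˡ 0ℚ)

  ΣΣ-upper-boundary : ∀ S → ΣΣ (upper (boundary G S)) ≡ cutᵇ S
  ΣΣ-upper-boundary S = +-self-injective (begin
    ΣΣ (upper (boundary G S)) + ΣΣ (upper (boundary G S)) ≡⟨ ΣΣ-upper (boundary G S) symmetric diagonal ⟨
    ΣΣ (boundary G S)                                     ≡⟨ ΣΣ-boundary S ⟩
    cutᵇ S + cutᵇ (λ u → not (S u))                       ≡⟨ cong (cutᵇ S +_) (cutᵇ-not S) ⟩
    cutᵇ S + cutᵇ S                                       ∎)
    where
    open ≡-Reasoning
    symmetric : ∀ u v → boundary G S u v ≡ boundary G S v u
    symmetric u v with S u | S v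
    ... | true  | true  = refl
    ... | true  | false = w-sym G u v
    ... | false | true  = w-sym G u v
    ... | false | false = refl
    diagonal : ∀ u → boundary G S u u ≡ 0ℚ
    diagonal u with S u
    ... | true  = refl
    ... | false = refl

  half-volume : ℚ
  half-volume = vol G ⊤ ÷' ℕ→ℚ 2

  half-volume-twice : half-volume + half-volume ≡ sumF (deg G)
  half-volume-twice = begin
    half-volume + half-volume     ≡⟨ *-two half-volume ⟨
    half-volume * ℕ→ℚ 2           ≡⟨ ÷'-cancelʳ (vol G ⊤) (toWitness {a? = 0ℚ <? ℕ→ℚ 2} tt) ⟩
    vol G ⊤                       ≡⟨ vol-⊤ ⟩
    sumF (deg G)                  ∎
    where
    open ≡-Reasoning
    open +-*-Solver
    *-two : ∀ x → x * ℕ→ℚ 2 ≡ x + x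
    *-two = solve 1 (λ x → x :* con (ℕ→ℚ 2) := x :+ x) refl

  complement-small : ∀ S → ¬ (mass (deg G) S ≤ half-volume) → mass (deg G) (λ x → not (S x)) ≤ half-volume
  complement-small S large with mass (deg G) (λ x → not (S x)) ≤? half-volume
  ... | yes small  = small
  ... | no  large′ = ⊥-elim (<-irrefl half-volume-twice (begin-strict
    half-volume + half-volume                            <⟨ +-mono-< (≰⇒> large) (≰⇒> large′) ⟩
    mass (deg G) S + mass (deg G) (λ x → not (S x))      ≡⟨ mass-complement S ⟩
    sumF (deg G)                                         ∎))
    where open ≤-Reasoning

module _ {n : ℕ} (G : WGraph n) {φ : ℚ} (deg-pos : ∀ u → 0ℚ < deg G u) (conductance : IsConductance G φ) where

  admissible-cut : ∀ S → Admissible G S → φ * vol G S ≤ cut G S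
  admissible-cut S adm@((u , Su) , _) =
    subst (φ * vol G S ≤_) (÷'-cancelʳ (cut G S) vol>0)
          (*-monoʳ-≤-≥0 (vol G S) (<⇒≤ vol>0) (proj₂ conductance S adm))
    where
    vol>0 : 0ℚ < vol G S
    vol>0 = <-≤-trans (deg-pos u) (mass-≥-member (deg-nonneg G) (lookup S) Su)

  small-side-cut : 0ℚ ≤ φ → ∀ S {u v L} → S u ≡ true → S v ≡ false → mass (deg G) S ≤ half-volume G →
                   L ≤ mass (deg G) S → φ * L ≤ cutᵇ G S
  small-side-cut φ≥0 S {u} {v} {L} Su Sv small L≤S = begin
    φ * L                     ≤⟨ *-monoˡ-≤-≥0 φ φ≥0 L≤S ⟩
    φ * mass (deg G) S        ≡⟨ cong (φ *_) (vol-tabulate G S) ⟨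
    φ * vol G (tabulate S)    ≤⟨ admissible-cut (tabulate S) admissible ⟩
    cut G (tabulate S)        ≡⟨ cut-tabulate G S ⟩
    cutᵇ G S                  ∎
    where
    open ≤-Reasoning
    admissible : Admissible G (tabulate S)
    admissible = (u , trans (lookup∘tabulate S u) Su) , (v , trans (lookup∘tabulate S v) Sv)
               , subst (_≤ half-volume G) (sym (vol-tabulate G S)) small

  -- Whichever of S and its complement has at most half the volume is admissible.
  cut-≥-conductance : 0ℚ ≤ φ → ∀ S {u v L} → S u ≡ true → S v ≡ false →
                      L ≤ mass (deg G) S → L ≤ mass (deg G) (λ x → not (S x)) → φ * L ≤ cutᵇ G S
  cut-≥-conductance φ≥0 S {u} {v} {L} Su Sv L≤S L≤S′ with mass (deg G) S ≤? half-volume G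
  ... | yes small = small-side-cut φ≥0 S Su Sv small L≤S
  ... | no  large = subst (φ * L ≤_) (cutᵇ-not G S)
    (small-side-cut φ≥0 (λ x → not (S x)) (cong not Sv) (cong not Su) (complement-small G S large) L≤S′)

balanced-thirds : ∀ {a b c t} → a ≤ t + t → t + t < a + b → b ≤ a → a + c ≡ (t + t) + t → t ≤ a × t ≤ c
balanced-thirds {a} {b} {c} {t} a≤2t 2t<a+b b≤a a+c≡3t = t≤a , t≤c
  where
  t≤a : t ≤ a
  t≤a with t ≤? a
  ... | yes t≤a = t≤a
  ... | no  t≰a = ⊥-elim (<-asym 2t<a+b (≤-<-trans (+-monoʳ-≤ a b≤a) (+-mono-< (≰⇒> t≰a) (≰⇒> t≰a))))
  t≤c : t ≤ c
  t≤c with t ≤? c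
  ... | yes t≤c = t≤c
  ... | no  t≰c = ⊥-elim (<-irrefl a+c≡3t (+-mono-≤-< a≤2t (≰⇒> t≰c)))

record Weighting {n} (G : WGraph n) (α β : ℚ) : Set where
  field
    f        : Fin n → ℚ
    f-nonneg : ∀ u → 0ℚ ≤ f u
    α-nonneg : 0ℚ ≤ α
    β-nonneg : 0ℚ ≤ β
    α*f≤deg  : ∀ u → α * f u ≤ deg G u
    f≤β      : ∀ u → f u ≤ β
    f≤half   : ∀ u → f u + f u ≤ sumF f
    total>0  : 0ℚ < sumF f

module _ {n : ℕ} {G : WGraph n} {φ : ℚ} (deg-pos : ∀ u → 0ℚ < deg G u) (conductance : IsConductance G φ)
         (φ≥0 : 0ℚ ≤ φ) {α β : ℚ} (W : Weighting G α β) {T : Tree n} (hc : IsHCTree T) where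

  open Weighting W

  private
    M t : ℚ
    M = sumF f
    t = M ÷' ℕ→ℚ 3

    M≡3t : M ≡ (t + t) + t
    M≡3t = trans (sym (÷'-cancelʳ M (toWitness {a? = 0ℚ <? ℕ→ℚ 3} tt))) (*-three t)
      where
      open +-*-Solver
      *-three : ∀ x → x * ℕ→ℚ 3 ≡ (x + x) + x
      *-three = solve 1 (λ x → x :* con (ℕ→ℚ 3) := (x :+ x) :+ x) refl

    t>0 : 0ℚ < t
    t>0 = ÷'-pos total>0 (toWitness {a? = 0ℚ <? ℕ→ℚ 3} tt)

    2t<M : t + t < M
    2t<M = subst (t + t <_) (sym M≡3t) (subst (_< (t + t) + t) (+-identityʳ (t + t)) (+-monoʳ-< (t + t) t>0))

    f≤2t : ∀ u → f u ≤ t + t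
    f≤2t u with f u ≤? t + t
    ... | yes fu≤2t = fu≤2t
    ... | no  fu≰2t = ⊥-elim (<-irrefl (sym (cong (λ x → x + x) M≡3t)) (begin-strict
      ((t + t) + t) + ((t + t) + t)      ≡⟨ regroup t ⟩
      ((t + t) + (t + t)) + (t + t)      <⟨ +-mono-< (+-mono-< (≰⇒> fu≰2t) (≰⇒> fu≰2t)) (≰⇒> fu≰2t) ⟩
      (f u + f u) + f u                  ≤⟨ +-mono-≤ (f≤half u) (≤-trans fu≤2fu (f≤half u)) ⟩
      M + M                              ∎))
      where
      open ≤-Reasoning
      open +-*-Solver
      regroup : ∀ x → ((x + x) + x) + ((x + x) + x) ≡ ((x + x) + (x + x)) + (x + x)
      regroup = solve 1 (λ x → ((x :+ x) :+ x) :+ ((x :+ x) :+ x) := ((x :+ x) :+ (x :+ x)) :+ (x :+ x)) refl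
      fu≤2fu : f u ≤ f u + f u
      fu≤2fu = subst (_≤ f u + f u) (+-identityʳ (f u)) (+-monoʳ-≤ (f u) (f-nonneg u))

    weight-T : weight f T ≡ M
    weight-T = mass-full (λ u → ∈⇒member (proj₂ hc u))

    weight-≤-β*size : ∀ {xs} → Unique xs → mass f (member xs) ≤ β * ℕ→ℚ (length xs)
    weight-≤-β*size {xs} unique = subst (_ ≤_) (mass-const β unique) (mass-mono f≤β (member xs))

    α*-≤-vol : ∀ S → t ≤ mass f S → α * t ≤ mass (deg G) S
    α*-≤-vol S t≤fS = ≤-trans (*-monoˡ-≤-≥0 α α-nonneg t≤fS)
                              (subst (_≤ mass (deg G) S) (mass-* α S) (mass-mono α*f≤deg S))

    module Balanced (b : BalancedSiblings f (t + t) T) where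
      open BalancedSiblings b

      K Y : ℚ
      K = ℕ→ℚ (size N ℕ.+ size R)
      Y = ΣΣ (upper (boundary G (member (leaves N))))

      N++R : Unique (leaves N) × Unique (leaves R) × Disjoint (leaves N) (leaves R)
      N++R = Unique-++⁻ (leaves N) (siblings-Unique (proj₁ hc) siblings)

      cut-bound : φ * (α * t) ≤ Y
      cut-bound =
        let _ , x∈N = leaves-nonempty N
            _ , y∈R = leaves-nonempty R
        in subst (φ * (α * t) ≤_) (sym (ΣΣ-upper-boundary G (member (leaves N))))
             (cut-≥-conductance G deg-pos conductance φ≥0 (member (leaves N))
               (∈⇒member x∈N) (∉⇒member (λ y∈N → proj₂ (proj₂ N++R) (y∈N , y∈R)))
               (α*-≤-vol _ (proj₁ thirds)) (α*-≤-vol _ (proj₂ thirds)))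
        where
        thirds : t ≤ weight f N × t ≤ mass f (λ u → not (member (leaves N) u))
        thirds = balanced-thirds N-light NR-heavy R≤N (trans (mass-complement (member (leaves N))) M≡3t)

      size-bound : t + t ≤ β * K
      size-bound = begin
        t + t                                  ≤⟨ <⇒≤ NR-heavy ⟩
        weight f N + weight f R                ≤⟨ +-mono-≤ (weight-≤-β*size (proj₁ N++R))
                                                           (weight-≤-β*size (proj₁ (proj₂ N++R))) ⟩
        β * ℕ→ℚ (size N) + β * ℕ→ℚ (size R)    ≡⟨ *-distribˡ-+ β _ _ ⟨
        β * (ℕ→ℚ (size N) + ℕ→ℚ (size R))      ≡⟨ cong (β *_) (ℕ→ℚ-+ (size N) (size R)) ⟨
        β * K                                  ∎
        where open ≤-Reasoning

      cost-bound : (t + t) * (φ * (α * t)) ≤ β * cost G T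
      cost-bound = begin
        (t + t) * (φ * (α * t))    ≤⟨ *-monoʳ-≤-≥0 _ φαt≥0 size-bound ⟩
        (β * K) * (φ * (α * t))    ≤⟨ *-monoˡ-≤-≥0 (β * K) βK≥0 cut-bound ⟩
        (β * K) * Y                ≡⟨ *-assoc β K Y ⟩
        β * (K * Y)                ≤⟨ *-monoˡ-≤-≥0 β β-nonneg (cost-lower G hc siblings) ⟩
        β * cost G T               ∎
        where
        open ≤-Reasoning
        φαt≥0 : 0ℚ ≤ φ * (α * t)
        φαt≥0 = *-nonneg φ≥0 (*-nonneg α-nonneg (<⇒≤ t>0))
        βK≥0 : 0ℚ ≤ β * K
        βK≥0 = *-nonneg β-nonneg (ℕ→ℚ-nonneg (size N ℕ.+ size R))

  cost-lower-bound : ℕ→ℚ 2 * (φ * (α * (sumF f * sumF f))) ≤ ℕ→ℚ 9 * (β * cost G T)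
  cost-lower-bound = begin
    ℕ→ℚ 2 * (φ * (α * (M * M)))                          ≡⟨ cong (λ m → ℕ→ℚ 2 * (φ * (α * (m * m)))) M≡3t ⟩
    ℕ→ℚ 2 * (φ * (α * (((t + t) + t) * ((t + t) + t))))  ≡⟨ rearrange t φ α ⟩
    ℕ→ℚ 9 * ((t + t) * (φ * (α * t)))                    ≤⟨ *-monoˡ-≤-≥0 (ℕ→ℚ 9) (ℕ→ℚ-nonneg 9)
                                                             (Balanced.cost-bound balanced-pair) ⟩
    ℕ→ℚ 9 * (β * cost G T)                               ∎
    where
    open ≤-Reasoning
    open +-*-Solver
    balanced-pair : BalancedSiblings f (t + t) T
    balanced-pair = balanced-siblings f≤2t T (proj₁ hc) (subst (t + t <_) (sym weight-T) 2t<M)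
    rearrange : ∀ x p a → ℕ→ℚ 2 * (p * (a * (((x + x) + x) * ((x + x) + x))))
                        ≡ ℕ→ℚ 9 * ((x + x) * (p * (a * x)))
    rearrange = solve 3 (λ x p a → con (ℕ→ℚ 2) :* (p :* (a :* (((x :+ x) :+ x) :* ((x :+ x) :+ x))))
                                := con (ℕ→ℚ 9) :* ((x :+ x) :* (p :* (a :* x)))) refl

minF-≤ : ∀ {m} (f : Fin (suc m) → ℚ) i → minF f ≤ f i
minF-≤ {zero}  f zero    = ≤-refl
minF-≤ {suc m} f zero    = p⊓q≤p (f zero) _
minF-≤ {suc m} f (suc i) = ≤-trans (p⊓q≤q (f zero) _) (minF-≤ (λ j → f (suc j)) i)

minF-pos : ∀ {m} (f : Fin (suc m) → ℚ) → (∀ i → 0ℚ < f i) → 0ℚ < minF f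
minF-pos {zero}  f f>0 = f>0 zero
minF-pos {suc m} f f>0 with ⊓-sel (f zero) (minF (λ j → f (suc j)))
... | inj₁ eq = subst (0ℚ <_) (sym eq) (f>0 zero)
... | inj₂ eq = subst (0ℚ <_) (sym eq) (minF-pos (λ j → f (suc j)) (λ j → f>0 (suc j)))

≤-maxF : ∀ {m} (f : Fin (suc m) → ℚ) i → f i ≤ maxF f
≤-maxF {zero}  f zero    = ≤-refl
≤-maxF {suc m} f zero    = p≤p⊔q (f zero) _
≤-maxF {suc m} f (suc i) = ≤-trans (≤-maxF (λ j → f (suc j)) i) (p≤q⊔p (f zero) _)

dMin-≤ : ∀ {n} (G : WGraph n) u → dMin G ≤ deg G u
dMin-≤ {suc m} G = minF-≤ (deg G)

dMin-pos : ∀ {n} (G : WGraph n) → (∀ u → 0ℚ < deg G u) → Fin n → 0ℚ < dMin G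
dMin-pos {suc m} G deg>0 _ = minF-pos (deg G) deg>0

≤-dMax : ∀ {n} (G : WGraph n) u → deg G u ≤ dMax G
≤-dMax {suc m} G = ≤-maxF (deg G)

module _ {n : ℕ} (G : WGraph n) (deg-pos : ∀ u → 0ℚ < deg G u) where

  unit-weighting : 2 ℕ.≤ n → Weighting G (dMin G) 1ℚ
  unit-weighting 2≤n = record
    { f        = λ _ → 1ℚ
    ; f-nonneg = λ _ → 0≤1
    ; α-nonneg = <⇒≤ (dMin-pos G deg-pos (fromℕ< (ℕ.≤-trans (ℕ.s≤s ℕ.z≤n) 2≤n)))
    ; β-nonneg = 0≤1
    ; α*f≤deg  = λ u → subst (_≤ deg G u) (sym (*-identityʳ (dMin G))) (dMin-≤ G u)
    ; f≤β      = λ _ → ≤-refl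
    ; f≤half   = λ _ → subst₂ _≤_ (ℕ→ℚ-+ 1 1) (sym (sumF-one n)) (ℕ→ℚ-mono-≤ 2≤n)
    ; total>0  = subst (0ℚ <_) (sym (sumF-one n)) (ℕ→ℚ-pos (ℕ.≤-trans (ℕ.s≤s ℕ.z≤n) 2≤n))
    }
    where
    0≤1 : 0ℚ ≤ 1ℚ
    0≤1 = toWitness {a? = 0ℚ ≤? 1ℚ} tt

  degree-weighting : Fin n → Weighting G 1ℚ (dMax G)
  degree-weighting v₀ = record
    { f        = deg G
    ; f-nonneg = deg-nonneg G
    ; α-nonneg = toWitness {a? = 0ℚ ≤? 1ℚ} tt
    ; β-nonneg = ≤-trans (deg-nonneg G v₀) (≤-dMax G v₀)
    ; α*f≤deg  = λ u → ≤-reflexive (*-identityˡ (deg G u))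
    ; f≤β      = ≤-dMax G
    ; f≤half   = deg-≤-half G
    ; total>0  = <-≤-trans (deg-pos v₀) (sumF-≥-term (deg-nonneg G) v₀)
    }

approximation-ratio : ∀ {φ c β q N V cost opt} → 0ℚ < φ → 0ℚ < c → 0ℚ ≤ N * V →
                      cost + cost ≤ N * V → ℕ→ℚ 2 * (φ * c) ≤ ℕ→ℚ 9 * (β * opt) → q * c ≡ β * (N * V) →
                      cost ≤ ((ℕ→ℚ 9 ÷' (ℕ→ℚ 4 * φ)) * q) * opt
approximation-ratio {φ} {c} {β} {q} {N} {V} {cost} {opt} φ>0 c>0 NV≥0 upper lower qc =
  *-cancelʳ-≤->0 (F * c) (*-pos F>0 c>0) (begin
    cost * (F * c)                         ≡⟨ regroup₁ cost φ c ⟩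
    (cost + cost) * (ℕ→ℚ 2 * (φ * c))      ≤⟨ *-monoʳ-≤-≥0 _ 2φc≥0 upper ⟩
    (N * V) * (ℕ→ℚ 2 * (φ * c))            ≤⟨ *-monoˡ-≤-≥0 (N * V) NV≥0 lower ⟩
    (N * V) * (ℕ→ℚ 9 * (β * opt))          ≡⟨ regroup₂ N V β opt ⟩
    ℕ→ℚ 9 * ((β * (N * V)) * opt)          ≡⟨ cong (λ x → ℕ→ℚ 9 * (x * opt)) qc ⟨
    ℕ→ℚ 9 * ((q * c) * opt)                ≡⟨ cong (λ x → x * ((q * c) * opt)) (÷'-cancelʳ (ℕ→ℚ 9) F>0) ⟨
    (r * F) * ((q * c) * opt)              ≡⟨ regroup₃ r F q c opt ⟩
    ((r * q) * opt) * (F * c)              ∎)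
  where
  open ≤-Reasoning
  open +-*-Solver
  F = ℕ→ℚ 4 * φ
  r = ℕ→ℚ 9 ÷' F
  F>0 : 0ℚ < F
  F>0 = *-pos (toWitness {a? = 0ℚ <? ℕ→ℚ 4} tt) φ>0
  2φc≥0 : 0ℚ ≤ ℕ→ℚ 2 * (φ * c)
  2φc≥0 = *-nonneg (ℕ→ℚ-nonneg 2) (*-nonneg (<⇒≤ φ>0) (<⇒≤ c>0))
  regroup₁ : ∀ x p c → x * ((ℕ→ℚ 4 * p) * c) ≡ (x + x) * (ℕ→ℚ 2 * (p * c))
  regroup₁ = solve 3 (λ x p c → x :* ((con (ℕ→ℚ 4) :* p) :* c)
                              := (x :+ x) :* (con (ℕ→ℚ 2) :* (p :* c))) refl
  regroup₂ : ∀ a b c d → (a * b) * (ℕ→ℚ 9 * (c * d)) ≡ ℕ→ℚ 9 * ((c * (a * b)) * d)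
  regroup₂ = solve 4 (λ a b c d → (a :* b) :* (con (ℕ→ℚ 9) :* (c :* d))
                                := con (ℕ→ℚ 9) :* ((c :* (a :* b)) :* d)) refl
  regroup₃ : ∀ a b c d e → (a * b) * ((c * d) * e) ≡ ((a * c) * e) * (b * d)
  regroup₃ = solve 5 (λ a b c d e → (a :* b) :* ((c :* d) :* e) := ((a :* c) :* e) :* (b :* d)) refl

≤-⊓-scaled : ∀ {x r a b c} → x ≤ (r * a) * c → x ≤ (r * b) * c → x ≤ (r * (a ⊓ b)) * c
≤-⊓-scaled {x} {r} {a} {b} {c} x≤a x≤b with ⊓-sel a b
... | inj₁ a⊓b≡a = subst (λ q → x ≤ (r * q) * c) (sym a⊓b≡a) x≤a
... | inj₂ a⊓b≡b = subst (λ q → x ≤ (r * q) * c) (sym a⊓b≡b) x≤b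

conductance⇒2≤n : ∀ {n} {G : WGraph n} {φ : ℚ} → IsConductance G φ → 2 ℕ.≤ n
conductance⇒2≤n ((S , ((u , Su) , (v , Sv) , _) , _) , _) = distinct⇒2≤n u≢v
  where
  u≢v : u ≢ v
  u≢v refl with trans (sym Su) Sv
  ... | ()
  distinct⇒2≤n : ∀ {n} {u v : Fin n} → u ≢ v → 2 ℕ.≤ n
  distinct⇒2≤n {suc zero}    {zero} {zero} u≢v = ⊥-elim (u≢v refl)
  distinct⇒2≤n {suc (suc n)} _                 = ℕ.s≤s (ℕ.s≤s ℕ.z≤n)

min-ratio-identity : ∀ {a d m V} → 0ℚ < d → a * m ≡ V → (a ÷' d) * (d * (m * m)) ≡ 1ℚ * (m * V)
min-ratio-identity {a} {d} {m} {V} d>0 am≡V = begin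
  (a ÷' d) * (d * (m * m))     ≡⟨ regroup (a ÷' d) d m ⟩
  ((a ÷' d) * d) * m * m       ≡⟨ cong (λ x → x * m * m) (÷'-cancelʳ a d>0) ⟩
  a * m * m                    ≡⟨ cong (_* m) am≡V ⟩
  V * m                        ≡⟨ trans (*-comm V m) (sym (*-identityˡ (m * V))) ⟩
  1ℚ * (m * V)                 ∎
  where
  open ≡-Reasoning
  open +-*-Solver
  regroup : ∀ x y z → x * (y * (z * z)) ≡ (x * y) * z * z
  regroup = solve 3 (λ x y z → x :* (y :* (z :* z)) := (x :* y) :* z :* z) refl

max-ratio-identity : ∀ {a D m V} → 0ℚ < a → a * m ≡ V → (D ÷' a) * (1ℚ * (V * V)) ≡ D * (m * V)
max-ratio-identity {a} {D} {m} {V} a>0 am≡V = begin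
  (D ÷' a) * (1ℚ * (V * V))    ≡⟨ cong (λ x → (D ÷' a) * (1ℚ * (x * V))) am≡V ⟨
  (D ÷' a) * (1ℚ * ((a * m) * V))
                               ≡⟨ regroup (D ÷' a) a m V ⟩
  ((D ÷' a) * a) * (m * V)     ≡⟨ cong (_* (m * V)) (÷'-cancelʳ D a>0) ⟩
  D * (m * V)                  ∎
  where
  open ≡-Reasoning
  open +-*-Solver
  regroup : ∀ x y z v → x * (1ℚ * ((y * z) * v)) ≡ (x * y) * (z * v)
  regroup = solve 4 (λ x y z v → x :* (con 1ℚ :* ((y :* z) :* v)) := (x :* y) :* (z :* v)) refl

module _ {n : ℕ} {G : WGraph n} {φ opt : ℚ} (deg-pos : ∀ u → 0ℚ < deg G u) (conductance : IsConductance G φ)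
         (φ>0 : 0ℚ < φ) (optimal : IsOPT G opt) {T : Tree n} (hc : IsHCTree T) where

  private
    T* : Tree n
    T* = proj₁ (proj₁ optimal)
    hc* : IsHCTree T*
    hc* = proj₁ (proj₂ (proj₁ optimal))
    cost-T*≡opt : cost G T* ≡ opt
    cost-T*≡opt = proj₂ (proj₂ (proj₁ optimal))
    2≤n : 2 ℕ.≤ n
    2≤n = conductance⇒2≤n {G = G} conductance
    v₀ : Fin n
    v₀ = fromℕ< (ℕ.<⇒≤ 2≤n)
    N V : ℚ
    N = ℕ→ℚ n
    V = sumF (deg G)
    N>0 : 0ℚ < N
    N>0 = ℕ→ℚ-pos (ℕ.<⇒≤ 2≤n)
    V>0 : 0ℚ < V
    V>0 = Weighting.total>0 (degree-weighting G deg-pos v₀)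
    NV≥0 : 0ℚ ≤ N * V
    NV≥0 = *-nonneg (<⇒≤ N>0) (<⇒≤ V>0)
    dAvg*N≡V : dAvg G * N ≡ V
    dAvg*N≡V = ÷'-cancelʳ V N>0
    opt-lower : ∀ {α β} (W : Weighting G α β) →
                ℕ→ℚ 2 * (φ * (α * (sumF (Weighting.f W) * sumF (Weighting.f W)))) ≤ ℕ→ℚ 9 * (β * opt)
    opt-lower {α} {β} W = subst (λ x → _ ≤ ℕ→ℚ 9 * (β * x)) cost-T*≡opt
                                (cost-lower-bound deg-pos conductance (<⇒≤ φ>0) W {T*} hc*)

  cost-≤-dMin-ratio : cost G T ≤ ((ℕ→ℚ 9 ÷' (ℕ→ℚ 4 * φ)) * (dAvg G ÷' dMin G)) * opt
  cost-≤-dMin-ratio = approximation-ratio {β = 1ℚ} {N = N} {V = V} φ>0 (*-pos dMin>0 (*-pos N>0 N>0)) NV≥0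
    (cost-upper G {T} hc)
    (subst (λ m → ℕ→ℚ 2 * (φ * (dMin G * (m * m))) ≤ _) (sumF-one n)
           (opt-lower (unit-weighting G deg-pos 2≤n)))
    (min-ratio-identity dMin>0 dAvg*N≡V)
    where
    dMin>0 : 0ℚ < dMin G
    dMin>0 = dMin-pos G deg-pos v₀

  cost-≤-dMax-ratio : cost G T ≤ ((ℕ→ℚ 9 ÷' (ℕ→ℚ 4 * φ)) * (dMax G ÷' dAvg G)) * opt
  cost-≤-dMax-ratio = approximation-ratio {β = dMax G} {N = N} {V = V} φ>0
    (*-pos (toWitness {a? = 0ℚ <? 1ℚ} tt) (*-pos V>0 V>0)) NV≥0
    (cost-upper G {T} hc)
    (opt-lower (degree-weighting G deg-pos v₀))
    (max-ratio-identity (÷'-pos V>0 N>0) dAvg*N≡V)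

lemma3p1 : ∀ {n : ℕ} (G : WGraph n) (φ opt : ℚ)
           → (∀ u → 0ℚ < deg G u)
           → IsConductance G φ
           → 0ℚ < φ
           → IsOPT G opt
           → (T : Tree n) → IsHCTree T
           → cost G T ≤ ((ℕ→ℚ 9 ÷' (ℕ→ℚ 4 * φ))
                          * ((dAvg G ÷' dMin G) ⊓ (dMax G ÷' dAvg G)))
                         * opt
lemma3p1 G φ opt deg-pos conductance φ>0 optimal T hc =
  ≤-⊓-scaled {r = ℕ→ℚ 9 ÷' (ℕ→ℚ 4 * φ)} {a = dAvg G ÷' dMin G} {b = dMax G ÷' dAvg G} {c = opt}
    (cost-≤-dMin-ratio deg-pos conductance φ>0 optimal {T} hc)
    (cost-≤-dMax-ratio deg-pos conductance φ>0 optimal {T} hc)
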